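{- Let $\lambda$ be a wide partition and let $\mu=(1,1,\ldots,1)$ be a single column of height $h\le\lambda'_1+1$. Then $\lambda+\mu$ is wide.
   Context: For partitions $\alpha,\beta$ of the same integer, $\alpha\ge\beta$ (dominance) means $\sum_{k\le j}\alpha_k\ge\sum_{k\le j}\beta_k$ for all $j$; $\nu'$ is the conjugate of $\nu$ (so $\lambda'_1$ is the number of parts of $\lambda$). $\nu$ is a subpartition of $\lambda$ if the multiset of parts of $\nu$ is a submultiset of that of $\lambda$. $\lambda$ is wide if $\nu\ge\nu'$ for every subpartition $\nu$ of $\lambda$. For partitions $\lambda,\mu$, $\lambda+\mu$ is the partition whose $i$th part is $\lambda_i+\mu_i$ (missing parts treated as $0$). -}

module Defs where

open import Data.Nat using (ℕ; zero; suc; _+_; _≤_; _≥_; _<_; _⊔_; _≤?_)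
open import Data.Nat.ListAction using (sum)
open import Data.List using (List; []; _∷_; _++_; take; length; filter; applyUpTo; foldr)
open import Data.List.Relation.Unary.All using (All)
open import Data.List.Relation.Unary.Linked using (Linked)
open import Data.List.Relation.Binary.Permutation.Propositional using (_↭_)
open import Data.Product using (Σ; _×_)
open import Relation.Binary.PropositionalEquality using (_≡_)

IsPartition : List ℕ → Set
IsPartition xs = Linked _≥_ xs × All (0 <_) xs

conj : List ℕ → List ℕ
conj ν = applyUpTo (λ j → length (filter (suc j ≤?_) ν)) (foldr _⊔_ 0 ν)

_⊵_ : List ℕ → List ℕ → Set
α ⊵ β = (sum α ≡ sum β) × ((j : ℕ) → sum (take j β) ≤ sum (take j α))

SubMultiset : List ℕ → List ℕ → Set
SubMultiset ν la = Σ (List ℕ) (λ ρ → (ν ++ ρ) ↭ la)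

Wide : List ℕ → Set
Wide la = (ν : List ℕ) → IsPartition ν → SubMultiset ν la → ν ⊵ conj ν

_⊕_ : List ℕ → List ℕ → List ℕ
[] ⊕ ys = ys
(x ∷ xs) ⊕ [] = x ∷ xs
(x ∷ xs) ⊕ (y ∷ ys) = (x + y) ∷ (xs ⊕ ys)

{-# OPTIONS --safe #-}
-- ν ⊵ ν′ says that for every k the first k columns of ν, which hold Σᵢ min(νᵢ, k) cells,
-- hold no more cells than its first k rows.
-- A subpartition ν of λ + (1ʰ) is ρ + (1ˢ), where ρ removes one cell from each of the s parts
-- of ν exceeding λ_{h+1} (dropping parts that become empty): ρ is a subpartition of λ, and
-- since h ≤ ℓ(λ) + 1 at most one part empties, so s ≤ ℓ(ρ) + 1.
-- For k ≥ s the column adds s cells to the first k rows and at most s to the first k columns.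
-- For k = j + 1 ≤ s the first j + 1 columns of ν hold at most the first j columns of ρ plus
-- ℓ(ν) ≤ ℓ(ρ) + 1 ≤ ρ_{j+1} + j + 1 cells; the last step is dominance at k = 1 for the
-- subpartition (ρ_{j+1}, ρ_{j+2}, …) of λ.
module Submission where

open import Defs
open import Data.Nat using (ℕ; suc; _≤_)
open import Data.List using (List; length; replicate)

open import Data.Nat using (zero; pred; _+_; _∸_; _<_; _≥_; _⊓_; _⊔_; z≤n; s≤s)
open import Data.Nat.Properties
open import Data.Nat.ListAction using (sum)
open import Data.Nat.ListAction.Properties using (sum-++)
open import Data.Nat.Tactic.RingSolver using (solve-∀)
open import Data.List using ([]; _∷_; _++_; _∷ʳ_; [_]; take; drop; filter; map; applyUpTo; foldr)
open import Data.List.Properties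
  using (applyUpTo-∷ʳ; take-[]; take++drop≡id; drop-all; length-drop; length-filter; length-map; length-++;
         length-replicate; map-++; map-id-local; map-replicate; filter-++; filter-all; filter-none; filter-accept; filter-reject; ++-identityʳ)
  renaming (++-assoc to ++-assoc-≡)
open import Data.List.Relation.Unary.All as All using (All; []; _∷_)
open import Data.List.Relation.Unary.All.Properties using (all-filter; drop⁺; replicate⁺) renaming (map⁺ to All-map⁺)
open import Data.List.Relation.Unary.Linked as Linked using (Linked)
open import Data.List.Relation.Unary.Linked.Properties using (Linked⇒All) renaming (map⁺ to Linked-map⁺; filter⁺ to Linked-filter⁺)
open import Data.List.Relation.Binary.Permutation.Propositional using (_↭_; ↭-trans; ↭-reflexive)
import Data.List.Relation.Binary.Permutation.Propositional.Properties as ↭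
open import Data.Product using (∃₂; _×_; _,_; proj₁; proj₂)
open import Data.Sum using ([_,_]′)
open import Function using (_∘_; flip)
open import Function.Bundles using (_⇔_; mk⇔; Equivalence)
open import Relation.Binary.PropositionalEquality using (_≡_; refl; sym; trans; cong; cong₂; subst; subst₂; module ≡-Reasoning)
open import Relation.Nullary using (yes; no; ¬_; contradiction)

truncSum : ℕ → List ℕ → ℕ
truncSum k ν = sum (map (_⊓ k) ν)

columnLength : List ℕ → ℕ → ℕ
columnLength ν j = length (filter (suc j ≤?_) ν)

truncSum-zero : ∀ ν → truncSum 0 ν ≡ 0
truncSum-zero []      = refl
truncSum-zero (x ∷ ν) = cong₂ _+_ (⊓-zeroʳ x) (truncSum-zero ν)

truncSum-suc : ∀ k ν → truncSum (suc k) ν ≡ truncSum k ν + columnLength ν k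
truncSum-suc k []      = refl
truncSum-suc k (x ∷ ν) with suc k ≤? x
... | yes k<x = begin
  x ⊓ suc k + truncSum (suc k) ν              ≡⟨ cong₂ _+_ (m≥n⇒m⊓n≡n k<x) (truncSum-suc k ν) ⟩
  suc k + (truncSum k ν + columnLength ν k)   ≡⟨ shuffle k (truncSum k ν) (columnLength ν k) ⟩
  k + truncSum k ν + suc (columnLength ν k)   ≡⟨ cong (λ m → m + truncSum k ν + _) (sym (m≥n⇒m⊓n≡n (<⇒≤ k<x))) ⟩
  x ⊓ k + truncSum k ν + suc (columnLength ν k) ≡⟨ cong (λ xs → x ⊓ k + truncSum k ν + length xs) (filter-accept (suc k ≤?_) k<x) ⟨
  x ⊓ k + truncSum k ν + columnLength (x ∷ ν) k ∎
  where
  open ≡-Reasoning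
  shuffle : ∀ a b c → suc a + (b + c) ≡ a + b + suc c
  shuffle = solve-∀
... | no k≮x = begin
  x ⊓ suc k + truncSum (suc k) ν              ≡⟨ cong₂ _+_ (m≤n⇒m⊓n≡m (<⇒≤ x<sk)) (truncSum-suc k ν) ⟩
  x + (truncSum k ν + columnLength ν k)       ≡⟨ sym (+-assoc x _ _) ⟩
  x + truncSum k ν + columnLength ν k         ≡⟨ cong (λ m → m + truncSum k ν + _) (sym (m≤n⇒m⊓n≡m (≤-pred x<sk))) ⟩
  x ⊓ k + truncSum k ν + columnLength ν k     ≡⟨ cong (λ xs → x ⊓ k + truncSum k ν + length xs) (filter-reject (suc k ≤?_) k≮x) ⟨
  x ⊓ k + truncSum k ν + columnLength (x ∷ ν) k ∎
  where
  open ≡-Reasoning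
  x<sk : x < suc k
  x<sk = s≤s (≮⇒≥ k≮x)

parts≤max : ∀ ν → All (_≤ foldr _⊔_ 0 ν) ν
parts≤max []      = []
parts≤max (x ∷ ν) = m≤m⊔n x _ ∷ All.map (λ p → ≤-trans p (m≤n⊔m x _)) (parts≤max ν)

truncSum-bounded : ∀ {m} ν → All (_≤ m) ν → truncSum m ν ≡ sum ν
truncSum-bounded []      []       = refl
truncSum-bounded (x ∷ ν) (p ∷ ps) = cong₂ _+_ (m≤n⇒m⊓n≡m p) (truncSum-bounded ν ps)

truncSum-⊓-bounded : ∀ {m} k ν → All (_≤ m) ν → truncSum (k ⊓ m) ν ≡ truncSum k ν
truncSum-⊓-bounded k []      []       = refl
truncSum-⊓-bounded k (x ∷ ν) (p ∷ ps) = cong₂ _+_ x⊓[k⊓m]≡x⊓k (truncSum-⊓-bounded k ν ps)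
  where
  open ≡-Reasoning
  x⊓[k⊓m]≡x⊓k : x ⊓ (k ⊓ _) ≡ x ⊓ k
  x⊓[k⊓m]≡x⊓k = begin
    x ⊓ (k ⊓ _) ≡⟨ cong (x ⊓_) (⊓-comm k _) ⟩
    x ⊓ (_ ⊓ k) ≡⟨ ⊓-assoc x _ k ⟨
    x ⊓ _ ⊓ k   ≡⟨ cong (_⊓ k) (m≤n⇒m⊓n≡m p) ⟩
    x ⊓ k       ∎

take-applyUpTo : ∀ {A : Set} (f : ℕ → A) k n → take k (applyUpTo f n) ≡ applyUpTo f (k ⊓ n)
take-applyUpTo f zero    n       = refl
take-applyUpTo f (suc k) zero    = refl
take-applyUpTo f (suc k) (suc n) = cong (f 0 ∷_) (take-applyUpTo (f ∘ suc) k n)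

sum-applyUpTo-columnLength : ∀ ν k → sum (applyUpTo (columnLength ν) k) ≡ truncSum k ν
sum-applyUpTo-columnLength ν zero    = sym (truncSum-zero ν)
sum-applyUpTo-columnLength ν (suc k) = begin
  sum (applyUpTo (columnLength ν) (suc k))                  ≡⟨ cong sum (applyUpTo-∷ʳ (columnLength ν) k) ⟨
  sum (applyUpTo (columnLength ν) k ∷ʳ columnLength ν k)    ≡⟨ sum-++ (applyUpTo (columnLength ν) k) [ columnLength ν k ] ⟩
  sum (applyUpTo (columnLength ν) k) + (columnLength ν k + 0) ≡⟨ cong₂ _+_ (sum-applyUpTo-columnLength ν k) (+-identityʳ _) ⟩
  truncSum k ν + columnLength ν k                           ≡⟨ truncSum-suc k ν ⟨
  truncSum (suc k) ν                                        ∎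
  where open ≡-Reasoning

sum-take-conj : ∀ k ν → sum (take k (conj ν)) ≡ truncSum k ν
sum-take-conj k ν = begin
  sum (take k (conj ν))                                 ≡⟨ cong sum (take-applyUpTo (columnLength ν) k (foldr _⊔_ 0 ν)) ⟩
  sum (applyUpTo (columnLength ν) (k ⊓ foldr _⊔_ 0 ν)) ≡⟨ sum-applyUpTo-columnLength ν _ ⟩
  truncSum (k ⊓ foldr _⊔_ 0 ν) ν                        ≡⟨ truncSum-⊓-bounded k ν (parts≤max ν) ⟩
  truncSum k ν                                          ∎
  where open ≡-Reasoning

sum-conj : ∀ ν → sum (conj ν) ≡ sum ν
sum-conj ν = trans (sum-applyUpTo-columnLength ν _) (truncSum-bounded ν (parts≤max ν))

DominatesConj : List ℕ → Set
DominatesConj ν = ∀ k → truncSum k ν ≤ sum (take k ν)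

⊵conj⇔dominatesConj : ∀ ν → ν ⊵ conj ν ⇔ DominatesConj ν
⊵conj⇔dominatesConj ν = mk⇔
  (λ (_ , dom) k → subst (_≤ sum (take k ν)) (sum-take-conj k ν) (dom k))
  (λ dom → sym (sum-conj ν) , λ k → subst (_≤ sum (take k ν)) (sym (sum-take-conj k ν)) (dom k))

⊕-identityʳ : ∀ xs → xs ⊕ [] ≡ xs
⊕-identityʳ []       = refl
⊕-identityʳ (x ∷ xs) = refl

length-⊕ : ∀ xs ys → length (xs ⊕ ys) ≡ length xs ⊔ length ys
length-⊕ []       ys       = refl
length-⊕ (x ∷ xs) []       = refl
length-⊕ (x ∷ xs) (y ∷ ys) = cong suc (length-⊕ xs ys)

sum-take-⊕-column : ∀ ρ s k → sum (take k (ρ ⊕ replicate s 1)) ≡ sum (take k ρ) + k ⊓ s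
sum-take-⊕-column ρ       zero    k       = begin
  sum (take k (ρ ⊕ []))    ≡⟨ cong (sum ∘ take k) (⊕-identityʳ ρ) ⟩
  sum (take k ρ)           ≡⟨ +-identityʳ _ ⟨
  sum (take k ρ) + 0       ≡⟨ cong (sum (take k ρ) +_) (⊓-zeroʳ k) ⟨
  sum (take k ρ) + k ⊓ 0   ∎
  where open ≡-Reasoning
sum-take-⊕-column []      (suc s) zero    = refl
sum-take-⊕-column []      (suc s) (suc k) =
  cong suc (trans (sum-take-⊕-column [] s k) (cong (λ xs → sum xs + k ⊓ s) (take-[] k)))
sum-take-⊕-column (x ∷ ρ) (suc s) zero    = refl
sum-take-⊕-column (x ∷ ρ) (suc s) (suc k) =
  trans (cong (x + 1 +_) (sum-take-⊕-column ρ s k)) (shuffle x (sum (take k ρ)) (k ⊓ s))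
  where
  shuffle : ∀ a b c → a + 1 + (b + c) ≡ a + b + suc c
  shuffle = solve-∀

truncSum-⊕-column : ∀ k ρ s → truncSum k (ρ ⊕ replicate s 1) ≤ truncSum k ρ + s
truncSum-⊕-column k ρ       zero    = ≤-reflexive (trans (cong (truncSum k) (⊕-identityʳ ρ)) (sym (+-identityʳ _)))
truncSum-⊕-column k []      (suc s) = +-mono-≤ (m⊓n≤m 1 k) (truncSum-⊕-column k [] s)
truncSum-⊕-column k (x ∷ ρ) (suc s) = begin
  (x + 1) ⊓ k + truncSum k (ρ ⊕ replicate s 1) ≤⟨ +-mono-≤ [x+1]⊓k≤x⊓k+1 (truncSum-⊕-column k ρ s) ⟩
  x ⊓ k + 1 + (truncSum k ρ + s)               ≡⟨ shuffle (x ⊓ k) (truncSum k ρ) s ⟩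
  x ⊓ k + truncSum k ρ + suc s                 ∎
  where
  open ≤-Reasoning
  [x+1]⊓k≤x⊓k+1 : (x + 1) ⊓ k ≤ x ⊓ k + 1
  [x+1]⊓k≤x⊓k+1 = ≤-trans (⊓-monoʳ-≤ (x + 1) (m≤m+n k 1)) (≤-reflexive (sym (+-distribʳ-⊓ 1 x k)))
  shuffle : ∀ a b c → a + 1 + (b + c) ≡ a + b + suc c
  shuffle = solve-∀

truncSum-suc≤ : ∀ j ν → truncSum (suc j) ν ≤ truncSum j ν + length ν
truncSum-suc≤ j ν = begin
  truncSum (suc j) ν              ≡⟨ truncSum-suc j ν ⟩
  truncSum j ν + columnLength ν j ≤⟨ +-monoʳ-≤ (truncSum j ν) (length-filter (suc j ≤?_) ν) ⟩
  truncSum j ν + length ν         ∎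
  where open ≤-Reasoning

truncSum-suc-⊕-column : ∀ j ρ s → truncSum (suc j) (ρ ⊕ replicate s 1) ≤ truncSum j ρ + length (ρ ⊕ replicate s 1)
truncSum-suc-⊕-column j ρ       zero    = subst (λ ν → truncSum (suc j) ν ≤ truncSum j ρ + length ν)
                                            (sym (⊕-identityʳ ρ)) (truncSum-suc≤ j ρ)
truncSum-suc-⊕-column j []      (suc s) = s≤s (truncSum-suc-⊕-column j [] s)
truncSum-suc-⊕-column j (x ∷ ρ) (suc s) = begin
  (x + 1) ⊓ suc j + truncSum (suc j) (ρ ⊕ replicate s 1)  ≡⟨ cong (λ y → y ⊓ suc j + truncSum (suc j) (ρ ⊕ replicate s 1)) (+-comm x 1) ⟩
  suc (x ⊓ j + truncSum (suc j) (ρ ⊕ replicate s 1))      ≤⟨ s≤s (+-monoʳ-≤ (x ⊓ j) (truncSum-suc-⊕-column j ρ s)) ⟩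
  suc (x ⊓ j + (truncSum j ρ + length (ρ ⊕ replicate s 1))) ≡⟨ shuffle (x ⊓ j) (truncSum j ρ) _ ⟩
  x ⊓ j + truncSum j ρ + suc (length (ρ ⊕ replicate s 1))   ∎
  where
  open ≤-Reasoning
  shuffle : ∀ a b c → suc (a + (b + c)) ≡ a + b + suc c
  shuffle = solve-∀

truncSum-one : ∀ {ν} → All (0 <_) ν → truncSum 1 ν ≡ length ν
truncSum-one []       = refl
truncSum-one (p ∷ ps) = cong₂ _+_ (m≥n⇒m⊓n≡n p) (truncSum-one ps)

sum-take-suc : ∀ j (xs : List ℕ) → sum (take (suc j) xs) ≡ sum (take j xs) + sum (take 1 (drop j xs))
sum-take-suc zero    xs       = refl
sum-take-suc (suc j) []       = refl
sum-take-suc (suc j) (x ∷ xs) = trans (cong (x +_) (sum-take-suc j xs)) (sym (+-assoc x _ _))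

dominatesConj-⊕-column : ∀ {ρ s} → All (0 <_) ρ → (∀ j → DominatesConj (drop j ρ)) → s ≤ suc (length ρ)
  → DominatesConj (ρ ⊕ replicate s 1)
dominatesConj-⊕-column {ρ} {s} pos dom s≤1+ℓ k = [ beyond k , within k ]′ (≤-total s k)
  where
  open ≤-Reasoning
  ν : List ℕ
  ν = ρ ⊕ replicate s 1

  beyond : ∀ k → s ≤ k → truncSum k ν ≤ sum (take k ν)
  beyond k s≤k = begin
    truncSum k ν           ≤⟨ truncSum-⊕-column k ρ s ⟩
    truncSum k ρ + s       ≤⟨ +-monoˡ-≤ s (dom 0 k) ⟩
    sum (take k ρ) + s     ≡⟨ cong (sum (take k ρ) +_) (m≥n⇒m⊓n≡n s≤k) ⟨
    sum (take k ρ) + k ⊓ s ≡⟨ sum-take-⊕-column ρ s k ⟨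
    sum (take k ν)         ∎

  length≤ : ∀ j → length ν ≤ sum (take 1 (drop j ρ)) + suc j
  length≤ j = begin
    length ν                           ≡⟨ trans (length-⊕ ρ (replicate s 1)) (cong (length ρ ⊔_) (length-replicate s)) ⟩
    length ρ ⊔ s                       ≤⟨ ⊔-lub (n≤1+n _) s≤1+ℓ ⟩
    suc (length ρ)                     ≤⟨ s≤s (m≤n+m∸n (length ρ) j) ⟩
    suc (j + (length ρ ∸ j))           ≡⟨ trans (cong suc (+-comm j _)) (sym (+-suc _ j)) ⟩
    length ρ ∸ j + suc j               ≡⟨ cong (_+ suc j) (trans (sym (length-drop j ρ)) (sym (truncSum-one (drop⁺ j pos)))) ⟩
    truncSum 1 (drop j ρ) + suc j      ≤⟨ +-monoˡ-≤ (suc j) (dom j 1) ⟩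
    sum (take 1 (drop j ρ)) + suc j    ∎

  within : ∀ k → k ≤ s → truncSum k ν ≤ sum (take k ν)
  within zero    _   = ≤-reflexive (truncSum-zero ν)
  within (suc j) j<s = begin
    truncSum (suc j) ν                                  ≤⟨ truncSum-suc-⊕-column j ρ s ⟩
    truncSum j ρ + length ν                             ≤⟨ +-mono-≤ (dom 0 j) (length≤ j) ⟩
    sum (take j ρ) + (sum (take 1 (drop j ρ)) + suc j) ≡⟨ +-assoc (sum (take j ρ)) _ _ ⟨
    sum (take j ρ) + sum (take 1 (drop j ρ)) + suc j   ≡⟨ cong (_+ suc j) (sum-take-suc j ρ) ⟨
    sum (take (suc j) ρ) + suc j                        ≡⟨ cong (sum (take (suc j) ρ) +_) (m≤n⇒m⊓n≡m j<s) ⟨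
    sum (take (suc j) ρ) + suc j ⊓ s                    ≡⟨ sum-take-⊕-column ρ s (suc j) ⟨
    sum (take (suc j) ν)                                ∎

subMultiset-trans : ∀ {ν μ la} → SubMultiset ν μ → SubMultiset μ la → SubMultiset ν la
subMultiset-trans {ν} (r , ν++r↭μ) (r′ , μ++r′↭la) =
  r ++ r′ , ↭-trans (↭-reflexive (sym (++-assoc-≡ ν r r′))) (↭-trans (↭.++⁺ʳ r′ ν++r↭μ) μ++r′↭la)

drop-subMultiset : ∀ j (xs : List ℕ) → SubMultiset (drop j xs) xs
drop-subMultiset j xs = take j xs , ↭-trans (↭.++-comm (drop j xs) (take j xs)) (↭-reflexive (take++drop≡id j xs))

linked-drop : ∀ {A : Set} {R : A → A → Set} j {xs} → Linked R xs → Linked R (drop j xs)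
linked-drop zero                 l = l
linked-drop (suc j) {[]}         l = l
linked-drop (suc j) {x ∷ xs}     l = linked-drop j (Linked.tail l)

drop-isPartition : ∀ j {ν} → IsPartition ν → IsPartition (drop j ν)
drop-isPartition j (dec , pos) = linked-drop j dec , drop⁺ j pos

wide-subMultiset : ∀ {ν la} → Wide la → SubMultiset ν la → Wide ν
wide-subMultiset wide ν⊆la μ μ-part μ⊆ν = wide μ μ-part (subMultiset-trans μ⊆ν ν⊆la)

wide⇒drop-dominatesConj : ∀ {ρ} → IsPartition ρ → Wide ρ → ∀ j → DominatesConj (drop j ρ)
wide⇒drop-dominatesConj {ρ} part wide j = Equivalence.to (⊵conj⇔dominatesConj (drop j ρ))
  (wide (drop j ρ) (drop-isPartition j part) (drop-subMultiset j ρ))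

head≥ : ∀ {x xs} → Linked _≥_ (x ∷ xs) → All (_≤ x) xs
head≥ dec = All.tail (Linked⇒All (flip ≤-trans) ≤-refl dec)

lower : ℕ → ℕ → ℕ
lower t x with t <? x
... | yes _ = pred x
... | no  _ = x

countAbove : ℕ → List ℕ → ℕ
countAbove t ν = length (filter (t <?_) ν)

lower-mono : ∀ t {x y} → x ≤ y → lower t x ≤ lower t y
lower-mono t {x} {y} x≤y with t <? x | t <? y
... | yes _   | yes _   = pred-mono-≤ x≤y
... | no _    | no _    = x≤y
... | yes t<x | no t≮y  = contradiction (<-≤-trans t<x x≤y) t≮y
... | no t≮x  | yes t<y = ≤-trans (≮⇒≥ t≮x) (<⇒≤pred t<y)

lower-above : ∀ {t x} → t < x → lower t x ≡ pred x
lower-above {t} {x} t<x with t <? x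
... | yes _   = refl
... | no t≮x  = contradiction t<x t≮x

lower-below : ∀ {t x} → x ≤ t → lower t x ≡ x
lower-below {t} {x} x≤t with t <? x
... | yes t<x = contradiction x≤t (<⇒≱ t<x)
... | no _    = refl

lower-suc : ∀ {t x} → t ≤ x → lower t (x + 1) ≡ x
lower-suc {t} {x} t≤x = trans (lower-above (≤-trans (s≤s t≤x) (≤-reflexive (+-comm 1 x)))) (m+n∸n≡m x 1)

lower0-≤1 : ∀ {x} → x ≤ 1 → lower 0 x ≡ 0
lower0-≤1 z≤n       = refl
lower0-≤1 (s≤s z≤n) = refl

lower-column-below : ∀ {t ν} → All (_≤ t) ν → All (0 <_) ν
  → ν ≡ filter (0 <?_) (map (lower t) ν) ⊕ replicate (countAbove t ν) 1
lower-column-below {t} {ν} ν≤t pos = begin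
  ν                                                               ≡⟨ ⊕-identityʳ ν ⟨
  ν ⊕ []                                                          ≡⟨ cong₂ (λ xs n → xs ⊕ replicate n 1) unchanged none-above ⟨
  filter (0 <?_) (map (lower t) ν) ⊕ replicate (countAbove t ν) 1 ∎
  where
  open ≡-Reasoning
  unchanged : filter (0 <?_) (map (lower t) ν) ≡ ν
  unchanged = trans (cong (filter (0 <?_)) (map-id-local (All.map lower-below ν≤t))) (filter-all (0 <?_) pos)
  none-above : countAbove t ν ≡ 0
  none-above = cong length (filter-none (t <?_) (All.map ≤⇒≯ ν≤t))

lower-column-above : ∀ {t x ν} → t < x → Linked _≥_ (x ∷ ν)
  → ν ≡ filter (0 <?_) (map (lower t) ν) ⊕ replicate (countAbove t ν) 1
  → x ∷ ν ≡ filter (0 <?_) (map (lower t) (x ∷ ν)) ⊕ replicate (countAbove t (x ∷ ν)) 1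
lower-column-above {.0} {suc zero} {ν} (s≤s z≤n) dec ν≡ = begin
  1 ∷ ν                                                         ≡⟨ cong (1 ∷_) ν≡ ⟩
  1 ∷ (filter (0 <?_) (map (lower 0) ν) ⊕ replicate (countAbove 0 ν) 1) ≡⟨ cong (λ xs → 1 ∷ (xs ⊕ replicate (countAbove 0 ν) 1)) vanish ⟩
  [] ⊕ replicate (suc (countAbove 0 ν)) 1                       ≡⟨ cong₂ (λ xs n → xs ⊕ replicate n 1) vanish (cong length (filter-accept (0 <?_) {x = 1} {xs = ν} (s≤s z≤n))) ⟨
  filter (0 <?_) (map (lower 0) (1 ∷ ν)) ⊕ replicate (countAbove 0 (1 ∷ ν)) 1 ∎
  where
  open ≡-Reasoning
  vanish : filter (0 <?_) (map (lower 0) ν) ≡ []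
  vanish = filter-none (0 <?_) (All-map⁺ (All.map (λ y≤1 → subst (λ z → ¬ 0 < z) (sym (lower0-≤1 y≤1)) (λ ())) (head≥ dec)))
lower-column-above {t} {suc (suc y)} {ν} t<x dec ν≡ = begin
  suc (suc y) ∷ ν                                               ≡⟨ cong₂ _∷_ (+-comm 1 (suc y)) ν≡ ⟩
  (suc y ∷ filter (0 <?_) (map (lower t) ν)) ⊕ replicate (suc (countAbove t ν)) 1
      ≡⟨ cong₂ (λ xs n → xs ⊕ replicate n 1) kept (cong length (filter-accept (t <?_) t<x)) ⟨
  filter (0 <?_) (map (lower t) (suc (suc y) ∷ ν)) ⊕ replicate (countAbove t (suc (suc y) ∷ ν)) 1 ∎
  where
  open ≡-Reasoning
  kept : filter (0 <?_) (map (lower t) (suc (suc y) ∷ ν)) ≡ suc y ∷ filter (0 <?_) (map (lower t) ν)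
  kept = trans (cong (λ z → filter (0 <?_) (z ∷ map (lower t) ν)) (lower-above t<x)) (filter-accept (0 <?_) {xs = map (lower t) ν} (s≤s z≤n))

lower-column : ∀ t {ν} → IsPartition ν → ν ≡ filter (0 <?_) (map (lower t) ν) ⊕ replicate (countAbove t ν) 1
lower-column t {[]}    _                 = refl
lower-column t {x ∷ ν} (dec , x>0 ∷ pos) = [ below , above ]′ (≤-<-connex x t)
  where
  below : x ≤ t → x ∷ ν ≡ filter (0 <?_) (map (lower t) (x ∷ ν)) ⊕ replicate (countAbove t (x ∷ ν)) 1
  below x≤t = lower-column-below (x≤t ∷ All.map (λ y≤x → ≤-trans y≤x x≤t) (head≥ dec)) (x>0 ∷ pos)
  above : t < x → x ∷ ν ≡ filter (0 <?_) (map (lower t) (x ∷ ν)) ⊕ replicate (countAbove t (x ∷ ν)) 1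
  above t<x = lower-column-above t<x dec (lower-column t (Linked.tail dec , pos))

foldr-⊔-lub : ∀ {m xs} → All (_≤ m) xs → foldr _⊔_ 0 xs ≤ m
foldr-⊔-lub []       = z≤n
foldr-⊔-lub (p ∷ ps) = ⊔-lub p (foldr-⊔-lub ps)

take≥max-drop : ∀ h {la} → Linked _≥_ la → All (foldr _⊔_ 0 (drop h la) ≤_) (take h la)
take≥max-drop zero             _   = []
take≥max-drop (suc h) {[]}     _   = []
take≥max-drop (suc h) {x ∷ la} dec = foldr-⊔-lub (drop⁺ h (head≥ dec)) ∷ take≥max-drop h (Linked.tail dec)

map-lower-⊕-column : ∀ {t} la h → All (t ≤_) (take h la) → All (_≤ t) (drop h la) → (length la < h → t ≡ 0)
  → map (lower t) (la ⊕ replicate h 1) ≡ la ++ replicate (h ∸ length la) 0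
map-lower-⊕-column []       zero    _              _     _   = refl
map-lower-⊕-column []       (suc h) _              _     t≡0 rewrite t≡0 (s≤s z≤n) = map-replicate (lower 0) (suc h) 1
map-lower-⊕-column (x ∷ la) zero    _              below _   =
  trans (map-id-local (All.map lower-below below)) (sym (++-identityʳ (x ∷ la)))
map-lower-⊕-column (x ∷ la) (suc h) (t≤x ∷ above) below t≡0 =
  cong₂ _∷_ (lower-suc t≤x) (map-lower-⊕-column la h above below (t≡0 ∘ s≤s))

map-lower-max-⊕-column : ∀ {la} h → Linked _≥_ la
  → map (lower (foldr _⊔_ 0 (drop h la))) (la ⊕ replicate h 1) ≡ la ++ replicate (h ∸ length la) 0
map-lower-max-⊕-column {la} h dec = map-lower-⊕-column la h (take≥max-drop h dec) (parts≤max (drop h la))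
  (λ ℓ<h → cong (foldr _⊔_ 0) (drop-all h la (<⇒≤ ℓ<h)))

filter-positive-++-zeros : ∀ {la} n → All (0 <_) la → filter (0 <?_) (la ++ replicate n 0) ≡ la
filter-positive-++-zeros {la} n pos = begin
  filter (0 <?_) (la ++ replicate n 0)                      ≡⟨ filter-++ (0 <?_) la (replicate n 0) ⟩
  filter (0 <?_) la ++ filter (0 <?_) (replicate n 0)       ≡⟨ cong₂ _++_ (filter-all (0 <?_) pos) (filter-none (0 <?_) (replicate⁺ n λ ())) ⟩
  la ++ []                                                  ≡⟨ ++-identityʳ la ⟩
  la                                                        ∎
  where open ≡-Reasoning

positives-subMultiset : ∀ {la n} xs r → All (0 <_) la → (xs ++ r) ↭ (la ++ replicate n 0)
  → SubMultiset (filter (0 <?_) xs) la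
positives-subMultiset {la} {n} xs r pos xs++r↭ =
  filter (0 <?_) r , subst₂ _↭_ (filter-++ (0 <?_) xs r) (filter-positive-++-zeros n pos) (↭.filter-↭ (0 <?_) xs++r↭)

length≤positives+1 : ∀ {la n} xs r → All (0 <_) la → n ≤ 1 → (xs ++ r) ↭ (la ++ replicate n 0)
  → length xs ≤ suc (length (filter (0 <?_) xs))
length≤positives+1 {la} {n} xs r pos n≤1 xs++r↭ = +-cancelʳ-≤ (length r) _ _ (begin
  length xs + length r                                         ≡⟨ length-++ xs ⟨
  length (xs ++ r)                                             ≡⟨ ↭.↭-length xs++r↭ ⟩
  length (la ++ replicate n 0)                                 ≡⟨ trans (length-++ la) (cong (length la +_) (length-replicate n)) ⟩
  length la + n                                                ≡⟨ cong (_+ n) (trans (sym (↭.↭-length ρ++r′↭la)) (length-++ ρ)) ⟩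
  length ρ + length r′ + n                                     ≤⟨ +-mono-≤ (+-monoʳ-≤ (length ρ) (length-filter (0 <?_) r)) n≤1 ⟩
  length ρ + length r + 1                                      ≡⟨ +-comm (length ρ + length r) 1 ⟩
  suc (length ρ + length r)                                    ∎)
  where
  open ≤-Reasoning
  ρ r′ : List ℕ
  ρ  = filter (0 <?_) xs
  r′ = filter (0 <?_) r
  ρ++r′↭la : (ρ ++ r′) ↭ la
  ρ++r′↭la = proj₂ (positives-subMultiset xs r pos xs++r↭)

subpartition-⊕-column : ∀ {la h ν} → IsPartition la → h ≤ suc (length la) → IsPartition ν → SubMultiset ν (la ⊕ replicate h 1)
  → ∃₂ λ ρ s → IsPartition ρ × SubMultiset ρ la × s ≤ suc (length ρ) × ν ≡ ρ ⊕ replicate s 1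
subpartition-⊕-column {la} {h} {ν} (la-dec , la-pos) h≤1+ℓ ν-part (r , ν++r↭) =
  ρ , countAbove t ν , ρ-part , positives-subMultiset ν↓ r↓ la-pos lowered , s≤1+ℓρ , lower-column t ν-part
  where
  -- the part λ_{h+1} of the partition la, or 0 if there is none
  t : ℕ
  t = foldr _⊔_ 0 (drop h la)
  ν↓ r↓ ρ : List ℕ
  ν↓ = map (lower t) ν
  r↓ = map (lower t) r
  ρ  = filter (0 <?_) ν↓

  lowered : (ν↓ ++ r↓) ↭ (la ++ replicate (h ∸ length la) 0)
  lowered = subst₂ _↭_ (map-++ (lower t) ν r) (map-lower-max-⊕-column h la-dec) (↭.map⁺ (lower t) ν++r↭)

  ρ-part : IsPartition ρ
  ρ-part = Linked-filter⁺ (0 <?_) (flip ≤-trans) (Linked-map⁺ (Linked.map (lower-mono t) (proj₁ ν-part))) , all-filter (0 <?_) ν↓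

  at-most-one-zero : h ∸ length la ≤ 1
  at-most-one-zero = subst (h ∸ length la ≤_) (m+n∸n≡m 1 (length la)) (∸-monoˡ-≤ (length la) h≤1+ℓ)

  s≤1+ℓρ : countAbove t ν ≤ suc (length ρ)
  s≤1+ℓρ = ≤-trans (length-filter (t <?_) ν)
    (subst (_≤ suc (length ρ)) (length-map (lower t) ν) (length≤positives+1 ν↓ r↓ la-pos at-most-one-zero lowered))

proposition4 : (la : List ℕ) (h : ℕ) → IsPartition la → Wide la
    → h ≤ suc (length la) → Wide (la ⊕ replicate h 1)
proposition4 la h la-part wide h≤1+ℓ ν ν-part ν⊆la⊕h
  with ρ , s , ρ-part , ρ⊆la , s≤1+ℓρ , refl ← subpartition-⊕-column la-part h≤1+ℓ ν-part ν⊆la⊕h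
  = Equivalence.from (⊵conj⇔dominatesConj (ρ ⊕ replicate s 1))
      (dominatesConj-⊕-column (proj₂ ρ-part) (wide⇒drop-dominatesConj ρ-part (wide-subMultiset wide ρ⊆la)) s≤1+ℓρ)
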